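{- Let $(W,S)$ be a Coxeter system with $S=\{s_0,s_1,\ldots,s_n\}$ and Coxeter matrix $(m_{ij})$, in which $s_0$ is a leaf node with unique neighbor $s_1$, i.e. $m_{0i}=2$ for $i=2,\ldots,n$. Then the alternating subgroup $W^+$ is generated by $R=\{r_1,\ldots,r_n\}$, $r_i=s_0s_i$, and has the presentation $$W^+\cong\langle r_1,\ldots,r_n:\ r_1^{m_{01}}=e,\ r_i^2=e\ (2\le i\le n),\ (r_ir_j)^{m_{ij}}=e\ (1\le i<j\le n)\rangle.$$
   Context: $(W,S)$ has presentation $\langle S: s_i^2=e,\ (s_is_j)^{m_{ij}}=e\ (i\ne j)\rangle$ with $m_{ij}=m_{ji}\in\{2,3,\ldots\}\cup\{\infty\}$ (relations with $\infty$ omitted). The alternating subgroup $W^+$ is the kernel of the sign character $\epsilon:W\to\{\pm1\}$, $\epsilon(s)=-1$ for $s\in S$. -}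

module Defs where

open import Data.Nat using (ℕ; zero; suc; _≤_)
open import Data.Fin using (Fin; zero; suc; toℕ; _<_)
open import Data.Bool using (Bool; true; false; not; _xor_)
open import Data.List using (List; []; _∷_; _++_; concatMap)
open import Data.Product using (Σ; _×_; _,_)
open import Data.Sum using (_⊎_)
open import Relation.Binary.PropositionalEquality using (_≡_)
open import Relation.Nullary using (¬_)

data ℕ∞ : Set where
  fin : ℕ → ℕ∞
  ∞   : ℕ∞

record IsCoxeterMatrix {k : ℕ} (m : Fin k → Fin k → ℕ∞) : Set where
  field
    symm    : ∀ i j → m i j ≡ m j i
    diag    : ∀ i → m i i ≡ fin 1
    offdiag : ∀ i j → ¬ (i ≡ j) →
              (m i j ≡ ∞) ⊎ Σ ℕ (λ a → (m i j ≡ fin a) × (2 ≤ a))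

-- Group presentations ⟨ A | relators ⟩ as setoids on free words.
-- A letter is (a , true) = a  or  (a , false) = a⁻¹.

Letter : Set → Set
Letter A = A × Bool

Word : Set → Set
Word A = List (Letter A)

invL : {A : Set} → Letter A → Letter A
invL (a , b) = (a , not b)

_^ʷ_ : {A : Set} → Word A → ℕ → Word A
w ^ʷ zero  = []
w ^ʷ suc k = w ++ (w ^ʷ k)

data PresEq {A : Set} (Rel : Word A → Set) : Word A → Word A → Set where
  ≈refl   : ∀ {u} → PresEq Rel u u
  ≈sym    : ∀ {u v} → PresEq Rel u v → PresEq Rel v u
  ≈trans  : ∀ {u v w} → PresEq Rel u v → PresEq Rel v w → PresEq Rel u w
  ≈cancel : ∀ u x v → PresEq Rel (u ++ x ∷ invL x ∷ v) (u ++ v)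
  ≈rel    : ∀ u r v → Rel r → PresEq Rel (u ++ r ++ v) (u ++ v)

gen : {A : Set} → A → Word A
gen a = (a , true) ∷ []

data CoxRel {k : ℕ} (m : Fin k → Fin k → ℕ∞) : Word (Fin k) → Set where
  sq   : ∀ i → CoxRel m ((gen i ++ gen i))
  braid : ∀ i j a → ¬ (i ≡ j) → m i j ≡ fin a →
          CoxRel m ((gen i ++ gen j) ^ʷ a)

_≈W[_]_ : {k : ℕ} → Word (Fin k) → (Fin k → Fin k → ℕ∞) → Word (Fin k) → Set
u ≈W[ m ] v = PresEq (CoxRel m) u v

-- Sign character ε : W → {±1}, with ε(s) = ε(s⁻¹) = -1, evaluated on words;
-- true stands for +1, false for -1.
sign : {A : Set} → Word A → Bool
sign []      = true
sign (_ ∷ w) = not (sign w)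

InW⁺ : {A : Set} → Word A → Set
InW⁺ w = sign w ≡ true

-- The claimed presentation of W⁺ on generators r_1..r_n, here indexed by
-- j : Fin n, with r_j corresponding to s_{suc j} (so toℕ j ≡ 0 is r_1).

data AltRel {n : ℕ} (m : Fin (suc n) → Fin (suc n) → ℕ∞) : Word (Fin n) → Set where
  r1pow : ∀ j a → toℕ j ≡ 0 → m zero (suc j) ≡ fin a → AltRel m (gen j ^ʷ a)
  risq  : ∀ j → 1 ≤ toℕ j → AltRel m (gen j ^ʷ 2)
  rbraid : ∀ i j a → i < j → m (suc i) (suc j) ≡ fin a →
           AltRel m ((gen i ++ gen j) ^ʷ a)

_≈P[_]_ : {n : ℕ} → Word (Fin n) → (Fin (suc n) → Fin (suc n) → ℕ∞) → Word (Fin n) → Set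
u ≈P[ m ] v = PresEq (AltRel m) u v

φL : {n : ℕ} → Letter (Fin n) → Word (Fin (suc n))
φL (j , true)  = (zero , true) ∷ (suc j , true) ∷ []
φL (j , false) = (suc j , false) ∷ (zero , false) ∷ []

φ : {n : ℕ} → Word (Fin n) → Word (Fin (suc n))
φ = concatMap φL

{-# OPTIONS --safe #-}
-- W⁺ has index 2 in W with transversal {e, s₀}. Every even word is a product of
-- pairs sᵢsⱼ, and each pair is a word in the rᵢ = s₀sᵢ, so φ is onto W⁺. The
-- relations of the presentation hold in W⁺ because s₀ commutes with sᵢ for i ≥ 2.
-- For injectivity, Reidemeister–Schreier rewriting τ reads a word of W letter by
-- letter, remembering whether the prefix read so far lies in W⁺ or in W⁺s₀, and
-- outputs a word in the rᵢ. It is a left inverse of φ and sends every Coxeter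
-- relation to a consequence of the relations of the presentation.
module Submission where

open import Defs
open import Data.Nat using (ℕ; _≤_)
open import Data.Fin using (Fin; zero; toℕ)
open import Data.Product using (_×_; ∃)
open import Relation.Binary.PropositionalEquality using (_≡_)

open import Data.Nat using (z≤n; s≤s)
open import Data.Nat.Properties using (≤-trans)
open import Data.Fin using (suc)
open import Data.Fin.Properties using (<-cmp; <⇒≢; suc-injective)
open import Data.Bool using (Bool; true; false; not)
open import Data.Bool.Properties using (not-involutive)
open import Data.List using ([]; _∷_; _++_)
open import Data.List.Properties using (++-assoc; ++-identityʳ)
open import Data.Product using (_,_; proj₁)
open import Data.Empty using (⊥-elim)
open import Function using (_∘_)
open import Level using (0ℓ)
open import Relation.Binary.Bundles using (Setoid)
open import Relation.Binary.Definitions using (tri<; tri≈; tri>)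
open import Relation.Binary.PropositionalEquality
  using (_≢_; refl; sym; trans; cong; subst₂; module ≡-Reasoning)
import Relation.Binary.Reasoning.Setoid as SetoidReasoning

module _ {A : Set} where

  ^ʷ-sucʳ : ∀ (w : Word A) a → w ^ʷ ℕ.suc a ≡ w ^ʷ a ++ w
  ^ʷ-sucʳ w ℕ.zero    = ++-identityʳ w
  ^ʷ-sucʳ w (ℕ.suc a) = begin
    w ++ w ^ʷ ℕ.suc a    ≡⟨ cong (w ++_) (^ʷ-sucʳ w a) ⟩
    w ++ (w ^ʷ a ++ w)   ≡⟨ ++-assoc w (w ^ʷ a) w ⟨
    w ^ʷ ℕ.suc a ++ w    ∎
    where open ≡-Reasoning

  ^ʷ-conjugate : ∀ (x y : Word A) a → (x ++ y) ^ʷ a ++ x ≡ x ++ (y ++ x) ^ʷ a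
  ^ʷ-conjugate x y ℕ.zero    = sym (++-identityʳ x)
  ^ʷ-conjugate x y (ℕ.suc a) = begin
    ((x ++ y) ++ (x ++ y) ^ʷ a) ++ x  ≡⟨ ++-assoc (x ++ y) _ x ⟩
    (x ++ y) ++ (x ++ y) ^ʷ a ++ x    ≡⟨ cong ((x ++ y) ++_) (^ʷ-conjugate x y a) ⟩
    (x ++ y) ++ x ++ (y ++ x) ^ʷ a    ≡⟨ ++-assoc x y _ ⟩
    x ++ y ++ x ++ (y ++ x) ^ʷ a      ≡⟨ cong (x ++_) (++-assoc y x _) ⟨
    x ++ (y ++ x) ++ (y ++ x) ^ʷ a    ∎
    where open ≡-Reasoning

  invL-involutive : ∀ (x : Letter A) → invL (invL x) ≡ x
  invL-involutive (a , b) = cong (a ,_) (not-involutive b)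

  inverse : Word A → Word A
  inverse []      = []
  inverse (x ∷ w) = inverse w ++ invL x ∷ []

  inverse-++ : ∀ u v → inverse (u ++ v) ≡ inverse v ++ inverse u
  inverse-++ []      v = sym (++-identityʳ (inverse v))
  inverse-++ (x ∷ u) v = begin
    inverse (u ++ v) ++ invL x ∷ []          ≡⟨ cong (_++ invL x ∷ []) (inverse-++ u v) ⟩
    (inverse v ++ inverse u) ++ invL x ∷ []  ≡⟨ ++-assoc (inverse v) (inverse u) _ ⟩
    inverse v ++ inverse (x ∷ u)             ∎
    where open ≡-Reasoning

  inverse-^ʷ : ∀ (w : Word A) a → inverse (w ^ʷ a) ≡ inverse w ^ʷ a
  inverse-^ʷ w ℕ.zero    = refl
  inverse-^ʷ w (ℕ.suc a) = begin
    inverse (w ++ w ^ʷ a)          ≡⟨ inverse-++ w (w ^ʷ a) ⟩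
    inverse (w ^ʷ a) ++ inverse w  ≡⟨ cong (_++ inverse w) (inverse-^ʷ w a) ⟩
    inverse w ^ʷ a ++ inverse w    ≡⟨ ^ʷ-sucʳ (inverse w) a ⟨
    inverse w ^ʷ ℕ.suc a           ∎
    where open ≡-Reasoning

  flips : Word A → Bool → Bool
  flips []      c = c
  flips (_ ∷ w) c = flips w (not c)

  flips-^ʷ : ∀ (y : Word A) → (∀ c → flips y c ≡ c) → ∀ a c → flips (y ^ʷ a) c ≡ c
  flips-^ʷ y fix ℕ.zero    c = refl
  flips-^ʷ y fix (ℕ.suc a) c = trans (flips-++ y) (trans (cong (flips (y ^ʷ a)) (fix c)) (flips-^ʷ y fix a c))
    where
    flips-++ : ∀ {v c} u → flips (u ++ v) c ≡ flips v (flips u c)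
    flips-++ []      = refl
    flips-++ (_ ∷ u) = flips-++ u

module PresEqProperties {A : Set} (Rel : Word A → Set) where

  infix 4 _≈_
  _≈_ : Word A → Word A → Set
  _≈_ = PresEq Rel

  setoid : Setoid 0ℓ 0ℓ
  setoid = record
    { Carrier       = Word A
    ; _≈_           = _≈_
    ; isEquivalence = record { refl = ≈refl ; sym = ≈sym ; trans = ≈trans }
    }

  open SetoidReasoning setoid

  ++-congˡ : ∀ w {u v} → u ≈ v → w ++ u ≈ w ++ v
  ++-congˡ w ≈refl            = ≈refl
  ++-congˡ w (≈sym p)         = ≈sym (++-congˡ w p)
  ++-congˡ w (≈trans p q)     = ≈trans (++-congˡ w p) (++-congˡ w q)
  ++-congˡ w (≈cancel u x v)  =
    subst₂ _≈_ (++-assoc w u _) (++-assoc w u v) (≈cancel (w ++ u) x v)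
  ++-congˡ w (≈rel u r v rel) =
    subst₂ _≈_ (++-assoc w u _) (++-assoc w u v) (≈rel (w ++ u) r v rel)

  ++-congʳ : ∀ w {u v} → u ≈ v → u ++ w ≈ v ++ w
  ++-congʳ w ≈refl            = ≈refl
  ++-congʳ w (≈sym p)         = ≈sym (++-congʳ w p)
  ++-congʳ w (≈trans p q)     = ≈trans (++-congʳ w p) (++-congʳ w q)
  ++-congʳ w (≈cancel u x v)  =
    subst₂ _≈_ (sym (++-assoc u _ w)) (sym (++-assoc u v w)) (≈cancel u x (v ++ w))
  ++-congʳ w (≈rel u r v rel) =
    subst₂ _≈_ (trans (cong (u ++_) (sym (++-assoc r v w))) (sym (++-assoc u (r ++ v) w)))
               (sym (++-assoc u v w))
               (≈rel u r (v ++ w) rel)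

  ++-cong : ∀ {u u′ v v′} → u ≈ u′ → v ≈ v′ → u ++ v ≈ u′ ++ v′
  ++-cong {u′ = u′} {v = v} p q = ≈trans (++-congʳ v p) (++-congˡ u′ q)

  relator≈[] : ∀ {r} → Rel r → r ≈ []
  relator≈[] {r} rel = subst₂ _≈_ (++-identityʳ r) refl (≈rel [] r [] rel)

  drop-trivial : ∀ u {r} v → r ≈ [] → u ++ r ++ v ≈ u ++ v
  drop-trivial u v p = ++-congˡ u (++-congʳ v p)

  ^ʷ-cong : ∀ {u v} a → u ≈ v → u ^ʷ a ≈ v ^ʷ a
  ^ʷ-cong ℕ.zero    p = ≈refl
  ^ʷ-cong (ℕ.suc a) p = ++-cong p (^ʷ-cong a p)

  inverseˡ : ∀ w → inverse w ++ w ≈ []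
  inverseˡ []      = ≈refl
  inverseˡ (x ∷ w) = begin
    (inverse w ++ invL x ∷ []) ++ x ∷ w       ≡⟨ ++-assoc (inverse w) _ _ ⟩
    inverse w ++ invL x ∷ x ∷ w               ≡⟨ cong (λ y → inverse w ++ invL x ∷ y ∷ w) (invL-involutive x) ⟨
    inverse w ++ invL x ∷ invL (invL x) ∷ w   ≈⟨ ≈cancel (inverse w) (invL x) w ⟩
    inverse w ++ w                            ≈⟨ inverseˡ w ⟩
    []                                        ∎

  inverse-≈[] : ∀ {w} → w ≈ [] → inverse w ≈ []
  inverse-≈[] {w} p = begin
    inverse w        ≡⟨ ++-identityʳ (inverse w) ⟨
    inverse w ++ []  ≈⟨ ++-congˡ (inverse w) p ⟨
    inverse w ++ w   ≈⟨ inverseˡ w ⟩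
    []               ∎

  inverse-^ʷ≈[] : ∀ w a → w ^ʷ a ≈ [] → inverse w ^ʷ a ≈ []
  inverse-^ʷ≈[] w a p = subst₂ _≈_ (inverse-^ʷ w a) refl (inverse-≈[] p)

  rotate-^ʷ≈[] : ∀ x y a → (x ++ y) ^ʷ a ≈ [] → (y ++ x) ^ʷ a ≈ []
  rotate-^ʷ≈[] x y a p = begin
    (y ++ x) ^ʷ a                      ≈⟨ ++-congʳ ((y ++ x) ^ʷ a) (inverseˡ x) ⟨
    (inverse x ++ x) ++ (y ++ x) ^ʷ a  ≡⟨ ++-assoc (inverse x) x _ ⟩
    inverse x ++ x ++ (y ++ x) ^ʷ a    ≡⟨ cong (inverse x ++_) (^ʷ-conjugate x y a) ⟨
    inverse x ++ (x ++ y) ^ʷ a ++ x    ≈⟨ drop-trivial (inverse x) x p ⟩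
    inverse x ++ x                     ≈⟨ inverseˡ x ⟩
    []                                 ∎

  self-inverse : ∀ x → x ∷ x ∷ [] ≈ [] → invL x ∷ [] ≈ x ∷ []
  self-inverse x p = begin
    invL x ∷ []                      ≈⟨ ++-congˡ (invL x ∷ []) p ⟨
    invL x ∷ x ∷ x ∷ []              ≡⟨ cong (λ y → invL x ∷ y ∷ x ∷ []) (invL-involutive x) ⟨
    invL x ∷ invL (invL x) ∷ x ∷ []  ≈⟨ ≈cancel [] (invL x) (x ∷ []) ⟩
    x ∷ []                           ∎

φ-++ : ∀ {n} (u v : Word (Fin n)) → φ (u ++ v) ≡ φ u ++ φ v
φ-++ []      v = refl
φ-++ (x ∷ u) v = trans (cong (φL x ++_) (φ-++ u v)) (sym (++-assoc (φL x) (φ u) (φ v)))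

φ-^ʷ : ∀ {n} (w : Word (Fin n)) a → φ (w ^ʷ a) ≡ φ w ^ʷ a
φ-^ʷ w ℕ.zero    = refl
φ-^ʷ w (ℕ.suc a) = trans (φ-++ w (w ^ʷ a)) (cong (φ w ++_) (φ-^ʷ w a))

sign-φ : ∀ {n} (u : Word (Fin n)) → InW⁺ (φ u)
sign-φ []              = refl
sign-φ ((_ , true) ∷ u)  = cong (not ∘ not) (sign-φ u)
sign-φ ((_ , false) ∷ u) = cong (not ∘ not) (sign-φ u)

module Coxeter {k : ℕ} (m : Fin k → Fin k → ℕ∞) where
  open PresEqProperties (CoxRel m)
  open SetoidReasoning setoid

  letter≈gen : ∀ x → x ∷ [] ≈ gen (proj₁ x)
  letter≈gen (i , true)  = ≈refl
  letter≈gen (i , false) = self-inverse (i , true) (relator≈[] (sq i))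

  commute : ∀ i j → i ≢ j → m i j ≡ fin 2 → gen i ++ gen j ≈ gen j ++ gen i
  commute i j i≢j mᵢⱼ≡2 = begin
    sᵢ ∷ sⱼ ∷ []
      ≈⟨ drop-trivial [] (sᵢ ∷ sⱼ ∷ []) (relator≈[] (sq j)) ⟨
    sⱼ ∷ sⱼ ∷ sᵢ ∷ sⱼ ∷ []
      ≈⟨ drop-trivial (sⱼ ∷ []) (sⱼ ∷ sᵢ ∷ sⱼ ∷ []) (relator≈[] (sq i)) ⟨
    sⱼ ∷ sᵢ ∷ sᵢ ∷ sⱼ ∷ sᵢ ∷ sⱼ ∷ []
      ≈⟨ drop-trivial (sⱼ ∷ sᵢ ∷ []) [] (relator≈[] (braid i j 2 i≢j mᵢⱼ≡2)) ⟩
    sⱼ ∷ sᵢ ∷ []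
      ∎
    where
    sᵢ = (i , true)
    sⱼ = (j , true)

module _ {n : ℕ} (m : Fin (ℕ.suc n) → Fin (ℕ.suc n) → ℕ∞) where
  open PresEqProperties (CoxRel m)
  open SetoidReasoning setoid
  open Coxeter m using (letter≈gen)

  pair∈image-φ : ∀ i j → ∃ λ u → φ u ≈ gen i ++ gen j
  pair∈image-φ zero    zero    = [] , ≈sym (relator≈[] (sq zero))
  pair∈image-φ zero    (suc j) = gen j , ≈refl
  pair∈image-φ (suc i) zero    = (i , false) ∷ [] , ++-cong (letter≈gen _) (letter≈gen _)
  pair∈image-φ (suc i) (suc j) = (i , false) ∷ (j , true) ∷ [] , (begin
    (suc i , false) ∷ (zero , false) ∷ (zero , true) ∷ (suc j , true) ∷ []
      ≈⟨ ≈cancel ((suc i , false) ∷ []) (zero , false) ((suc j , true) ∷ []) ⟩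
    (suc i , false) ∷ (suc j , true) ∷ []
      ≈⟨ ++-congʳ (gen (suc j)) (letter≈gen _) ⟩
    gen (suc i) ++ gen (suc j)
      ∎)

  φ-onto-InW⁺ : ∀ w → InW⁺ w → ∃ λ u → φ u ≈ w
  φ-onto-InW⁺ []          _    = [] , ≈refl
  φ-onto-InW⁺ (x ∷ y ∷ w) even
    with φ-onto-InW⁺ w (trans (sym (not-involutive (sign w))) even) | pair∈image-φ (proj₁ x) (proj₁ y)
  ... | u , φu≈w | v , φv≈xy = v ++ u , (begin
    φ (v ++ u)                           ≡⟨ φ-++ v u ⟩
    φ v ++ φ u                           ≈⟨ ++-cong φv≈xy φu≈w ⟩
    gen (proj₁ x) ++ gen (proj₁ y) ++ w  ≈⟨ ++-congʳ w (++-cong (letter≈gen x) (letter≈gen y)) ⟨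
    x ∷ y ∷ w                            ∎)

module Leaf {n : ℕ} (m : Fin (ℕ.suc n) → Fin (ℕ.suc n) → ℕ∞) (cox : IsCoxeterMatrix m)
            (leaf : ∀ i → 2 ≤ toℕ i → m zero i ≡ fin 2) where
  open IsCoxeterMatrix cox using (symm)
  module W = PresEqProperties (CoxRel m)
  module P = PresEqProperties (AltRel m)
  open W using () renaming (_≈_ to _≈W_)
  open P using () renaming (_≈_ to _≈P_)
  open Coxeter m using (commute)

  φL-cancel : ∀ x w → φL x ++ φL (invL x) ++ w ≈W w
  φL-cancel (j , true)  w =
    ≈trans (≈cancel ((zero , true) ∷ []) (suc j , true) ((zero , false) ∷ w)) (≈cancel [] (zero , true) w)
  φL-cancel (j , false) w =
    ≈trans (≈cancel ((suc j , false) ∷ []) (zero , false) ((suc j , true) ∷ w)) (≈cancel [] (suc j , false) w)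

  φ-r-^ʷ≈[] : ∀ j a → m zero (suc j) ≡ fin a → φ (gen j ^ʷ a) ≈W []
  φ-r-^ʷ≈[] j a m₀ⱼ≡a =
    subst₂ _≈W_ (sym (φ-^ʷ (gen j) a)) refl (W.relator≈[] (braid zero (suc j) a (λ ()) m₀ⱼ≡a))

  φ-relator : ∀ {r} → AltRel m r → φ r ≈W []
  φ-relator (r1pow j a _ m₀ⱼ≡a) = φ-r-^ʷ≈[] j a m₀ⱼ≡a
  φ-relator (risq j 1≤j)        = φ-r-^ʷ≈[] j 2 (leaf (suc j) (s≤s 1≤j))
  φ-relator (rbraid i j a i<j mᵢⱼ≡a) = begin
    φ ((gen i ++ gen j) ^ʷ a)       ≡⟨ φ-^ʷ (gen i ++ gen j) a ⟩
    (s₀ ∷ sᵢ ∷ s₀ ∷ sⱼ ∷ []) ^ʷ a   ≈⟨ W.^ʷ-cong a (W.++-congˡ (s₀ ∷ sᵢ ∷ []) s₀sⱼ≈sⱼs₀) ⟩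
    (s₀ ∷ sᵢ ∷ sⱼ ∷ s₀ ∷ []) ^ʷ a   ≈⟨ W.rotate-^ʷ≈[] (sᵢ ∷ sⱼ ∷ s₀ ∷ []) (s₀ ∷ []) a sᵢsⱼs₀s₀-^ʷ≈[] ⟩
    []                              ∎
    where
    open SetoidReasoning W.setoid
    s₀ = (zero , true)
    sᵢ = (suc i , true)
    sⱼ = (suc j , true)
    s₀sⱼ≈sⱼs₀ : s₀ ∷ sⱼ ∷ [] ≈W sⱼ ∷ s₀ ∷ []
    s₀sⱼ≈sⱼs₀ = commute zero (suc j) (λ ()) (leaf (suc j) (s≤s (≤-trans (s≤s z≤n) i<j)))
    sᵢsⱼs₀s₀-^ʷ≈[] : (sᵢ ∷ sⱼ ∷ s₀ ∷ s₀ ∷ []) ^ʷ a ≈W []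
    sᵢsⱼs₀s₀-^ʷ≈[] = ≈trans (W.^ʷ-cong a (W.drop-trivial (sᵢ ∷ sⱼ ∷ []) [] (W.relator≈[] (sq zero))))
                           (W.relator≈[] (braid (suc i) (suc j) a (<⇒≢ i<j ∘ suc-injective) mᵢⱼ≡a))

  φ-cong : ∀ {u v} → u ≈P v → φ u ≈W φ v
  φ-cong ≈refl        = ≈refl
  φ-cong (≈sym p)     = ≈sym (φ-cong p)
  φ-cong (≈trans p q) = ≈trans (φ-cong p) (φ-cong q)
  φ-cong (≈cancel u x v) = begin
    φ (u ++ x ∷ invL x ∷ v)            ≡⟨ φ-++ u _ ⟩
    φ u ++ φL x ++ φL (invL x) ++ φ v  ≈⟨ W.++-congˡ (φ u) (φL-cancel x (φ v)) ⟩
    φ u ++ φ v                         ≡⟨ φ-++ u v ⟨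
    φ (u ++ v)                         ∎
    where open SetoidReasoning W.setoid
  φ-cong (≈rel u r v rel) = begin
    φ (u ++ r ++ v)        ≡⟨ trans (φ-++ u (r ++ v)) (cong (φ u ++_) (φ-++ r v)) ⟩
    φ u ++ φ r ++ φ v      ≈⟨ W.drop-trivial (φ u) (φ v) (φ-relator rel) ⟩
    φ u ++ φ v             ≡⟨ φ-++ u v ⟨
    φ (u ++ v)             ∎
    where open SetoidReasoning W.setoid

  -- The flag c is true when the prefix read so far lies in W⁺s₀ rather than W⁺;
  -- ρ c k is the word in the rⱼ by which the W⁺-part grows when sₖ is read,
  -- from sⱼ₊₁ = rⱼ⁻¹s₀ and s₀sⱼ₊₁ = rⱼ.
  ρ : Bool → Fin (ℕ.suc n) → Word (Fin n)
  ρ c zero    = []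
  ρ c (suc j) = (j , c) ∷ []

  τ : Bool → Word (Fin (ℕ.suc n)) → Word (Fin n)
  τ c []      = []
  τ c (x ∷ w) = ρ c (proj₁ x) ++ τ (not c) w

  τ-++ : ∀ u v c → τ c (u ++ v) ≡ τ c u ++ τ (flips u c) v
  τ-++ []      v c = refl
  τ-++ (x ∷ u) v c = trans (cong (ρ c (proj₁ x) ++_) (τ-++ u v (not c))) (sym (++-assoc (ρ c (proj₁ x)) _ _))

  τ-^ʷ : ∀ y → (∀ c → flips y c ≡ c) → ∀ a c → τ c (y ^ʷ a) ≡ τ c y ^ʷ a
  τ-^ʷ y fix ℕ.zero    c = refl
  τ-^ʷ y fix (ℕ.suc a) c = begin
    τ c (y ++ y ^ʷ a)                ≡⟨ τ-++ y (y ^ʷ a) c ⟩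
    τ c y ++ τ (flips y c) (y ^ʷ a)  ≡⟨ cong (λ d → τ c y ++ τ d (y ^ʷ a)) (fix c) ⟩
    τ c y ++ τ c (y ^ʷ a)            ≡⟨ cong (τ c y ++_) (τ-^ʷ y fix a c) ⟩
    τ c y ^ʷ ℕ.suc a                 ∎
    where open ≡-Reasoning

  τ-φ : ∀ u → τ false (φ u) ≡ u
  τ-φ []              = refl
  τ-φ ((j , true) ∷ u)  = cong ((j , true) ∷_) (τ-φ u)
  τ-φ ((j , false) ∷ u) = cong ((j , false) ∷_) (τ-φ u)

  r-^ʷ≈[] : ∀ j a → m zero (suc j) ≡ fin a → gen j ^ʷ a ≈P []
  r-^ʷ≈[] zero    a m₀ⱼ≡a = P.relator≈[] (r1pow zero a refl m₀ⱼ≡a)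
  r-^ʷ≈[] (suc j) a m₀ⱼ≡a with trans (sym (leaf (suc (suc j)) (s≤s (s≤s z≤n)))) m₀ⱼ≡a
  ... | refl = P.relator≈[] (risq (suc j) (s≤s z≤n))

  r^±-^ʷ≈[] : ∀ c j a → m zero (suc j) ≡ fin a → ((j , c) ∷ []) ^ʷ a ≈P []
  r^±-^ʷ≈[] true  j a m₀ⱼ≡a = r-^ʷ≈[] j a m₀ⱼ≡a
  r^±-^ʷ≈[] false j a m₀ⱼ≡a = P.inverse-^ʷ≈[] (gen j) a (r-^ʷ≈[] j a m₀ⱼ≡a)

  r-self-inverse : ∀ j → 1 ≤ toℕ j → (j , false) ∷ [] ≈P (j , true) ∷ []
  r-self-inverse j 1≤j = P.self-inverse (j , true) (P.relator≈[] (risq j 1≤j))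

  rr-^ʷ≈[] : ∀ i j a → i ≢ j → m (suc i) (suc j) ≡ fin a → (gen i ++ gen j) ^ʷ a ≈P []
  rr-^ʷ≈[] i j a i≢j mᵢⱼ≡a with <-cmp i j
  ... | tri< i<j _ _ = P.relator≈[] (rbraid i j a i<j mᵢⱼ≡a)
  ... | tri≈ _ i≡j _ = ⊥-elim (i≢j i≡j)
  ... | tri> _ _ j<i =
    P.rotate-^ʷ≈[] (gen j) (gen i) a (P.relator≈[] (rbraid j i a j<i (trans (symm _ _) mᵢⱼ≡a)))

  r⁻¹r-^ʷ≈[] : ∀ i j a → i ≢ j → m (suc i) (suc j) ≡ fin a →
               ((i , false) ∷ (j , true) ∷ []) ^ʷ a ≈P []
  r⁻¹r-^ʷ≈[] zero zero a i≢j _ = ⊥-elim (i≢j refl)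
  r⁻¹r-^ʷ≈[] zero (suc j) a i≢j mᵢⱼ≡a =
    ≈trans (P.^ʷ-cong a (P.++-congˡ ((zero , false) ∷ []) (≈sym (r-self-inverse (suc j) (s≤s z≤n)))))
           (P.inverse-^ʷ≈[] (gen (suc j) ++ gen zero) a
              (rr-^ʷ≈[] (suc j) zero a (i≢j ∘ sym) (trans (symm _ _) mᵢⱼ≡a)))
  r⁻¹r-^ʷ≈[] (suc i) j a i≢j mᵢⱼ≡a =
    ≈trans (P.^ʷ-cong a (P.++-congʳ (gen j) (r-self-inverse (suc i) (s≤s z≤n))))
           (rr-^ʷ≈[] (suc i) j a i≢j mᵢⱼ≡a)

  rr⁻¹-^ʷ≈[] : ∀ i j a → i ≢ j → m (suc i) (suc j) ≡ fin a →
               ((i , true) ∷ (j , false) ∷ []) ^ʷ a ≈P []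
  rr⁻¹-^ʷ≈[] i j a i≢j mᵢⱼ≡a =
    P.inverse-^ʷ≈[] ((j , true) ∷ (i , false) ∷ []) a
      (P.rotate-^ʷ≈[] ((i , false) ∷ []) (gen j) a (r⁻¹r-^ʷ≈[] i j a i≢j mᵢⱼ≡a))

  τ-braid-^ʷ≈[] : ∀ c i j a → i ≢ j → m i j ≡ fin a → τ c (gen i ++ gen j) ^ʷ a ≈P []
  τ-braid-^ʷ≈[] c     zero    zero    a i≢j _     = ⊥-elim (i≢j refl)
  τ-braid-^ʷ≈[] c     zero    (suc j) a _   mᵢⱼ≡a = r^±-^ʷ≈[] (not c) j a mᵢⱼ≡a
  τ-braid-^ʷ≈[] c     (suc i) zero    a _   mᵢⱼ≡a = r^±-^ʷ≈[] c i a (trans (symm _ _) mᵢⱼ≡a)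
  τ-braid-^ʷ≈[] false (suc i) (suc j) a i≢j mᵢⱼ≡a = r⁻¹r-^ʷ≈[] i j a (i≢j ∘ cong suc) mᵢⱼ≡a
  τ-braid-^ʷ≈[] true  (suc i) (suc j) a i≢j mᵢⱼ≡a = rr⁻¹-^ʷ≈[] i j a (i≢j ∘ cong suc) mᵢⱼ≡a

  ρ-cancel : ∀ c k w → ρ c k ++ ρ (not c) k ++ w ≈P w
  ρ-cancel c zero    w = ≈refl
  ρ-cancel c (suc j) w = ≈cancel [] (j , c) w

  flips-relator : ∀ {r} → CoxRel m r → ∀ c → flips r c ≡ c
  flips-relator (sq i)            = not-involutive
  flips-relator (braid i j a _ _) = flips-^ʷ (gen i ++ gen j) not-involutive a

  τ-relator : ∀ {r} → CoxRel m r → ∀ c → τ c r ≈P []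
  τ-relator (sq i)                  c = ρ-cancel c i []
  τ-relator (braid i j a i≢j mᵢⱼ≡a) c = begin
    τ c ((gen i ++ gen j) ^ʷ a)  ≡⟨ τ-^ʷ (gen i ++ gen j) not-involutive a c ⟩
    τ c (gen i ++ gen j) ^ʷ a    ≈⟨ τ-braid-^ʷ≈[] c i j a i≢j mᵢⱼ≡a ⟩
    []                           ∎
    where open SetoidReasoning P.setoid

  τ-cong : ∀ {w w′} → w ≈W w′ → ∀ c → τ c w ≈P τ c w′
  τ-cong ≈refl        c = ≈refl
  τ-cong (≈sym p)     c = ≈sym (τ-cong p c)
  τ-cong (≈trans p q) c = ≈trans (τ-cong p c) (τ-cong q c)
  τ-cong (≈cancel u x v) c = begin
    τ c (u ++ x ∷ invL x ∷ v)                       ≡⟨ τ-++ u _ c ⟩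
    τ c u ++ ρ c′ k ++ ρ (not c′) k ++ τ (not (not c′)) v
                                                    ≈⟨ P.++-congˡ (τ c u) (ρ-cancel c′ k _) ⟩
    τ c u ++ τ (not (not c′)) v                     ≡⟨ cong (λ d → τ c u ++ τ d v) (not-involutive c′) ⟩
    τ c u ++ τ c′ v                                 ≡⟨ τ-++ u v c ⟨
    τ c (u ++ v)                                    ∎
    where
    open SetoidReasoning P.setoid
    c′ = flips u c
    k  = proj₁ x
  τ-cong (≈rel u r v rel) c = begin
    τ c (u ++ r ++ v)                    ≡⟨ τ-++ u (r ++ v) c ⟩
    τ c u ++ τ c′ (r ++ v)               ≡⟨ cong (τ c u ++_) (τ-++ r v c′) ⟩
    τ c u ++ τ c′ r ++ τ (flips r c′) v  ≡⟨ cong (λ d → τ c u ++ τ c′ r ++ τ d v) (flips-relator rel c′) ⟩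
    τ c u ++ τ c′ r ++ τ c′ v            ≈⟨ P.drop-trivial (τ c u) (τ c′ v) (τ-relator rel c′) ⟩
    τ c u ++ τ c′ v                      ≡⟨ τ-++ u v c ⟨
    τ c (u ++ v)                         ∎
    where
    open SetoidReasoning P.setoid
    c′ = flips u c

  φ-injective : ∀ {u v} → φ u ≈W φ v → u ≈P v
  φ-injective {u} {v} φu≈φv = subst₂ _≈P_ (τ-φ u) (τ-φ v) (τ-cong φu≈φv false)

proposition4p1 : (n : ℕ) (m : Fin (ℕ.suc n) → Fin (ℕ.suc n) → ℕ∞) →
    IsCoxeterMatrix m → 1 ≤ n →
    (∀ i → 2 ≤ toℕ i → m zero i ≡ fin 2) →
    (∀ (u : Word (Fin n)) → InW⁺ (φ u))
    × (∀ (w : Word (Fin (ℕ.suc n))) → InW⁺ w → ∃ λ (u : Word (Fin n)) → φ u ≈W[ m ] w)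
    × (∀ (u v : Word (Fin n)) → u ≈P[ m ] v → φ u ≈W[ m ] φ v)
    × (∀ (u v : Word (Fin n)) → φ u ≈W[ m ] φ v → u ≈P[ m ] v)
proposition4p1 n m cox _ leaf = sign-φ , φ-onto-InW⁺ m , (λ _ _ → φ-cong) , (λ _ _ → φ-injective)
  where open Leaf m cox leaf
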